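{- Combinatory ReFLect (CR) is not strongly normalizing: there exists a well-typed CR term $t$ and an infinite sequence $t = t_0 \to t_1 \to t_2 \to \cdots$ of one-step reductions.
   Context: Combinatory ReFLect (CR) is defined as follows. Types: $\sigma ::= \mathsf{bool} \mid \mathsf{unit} \mid \mathsf{term} \mid \sigma_1 \rightarrow \sigma_2$. Terms: $e ::= \mathsf{I}_\sigma \mid \mathsf{K}_{\sigma,\tau} \mid \mathsf{S}_{\sigma,\tau,\upsilon} \mid \mathsf{value}_\sigma \mid \mathsf{lift} \mid \mathsf{app} \mid e_1\,e_2 \mid \ulcorner e \urcorner$, where $\sigma,\tau,\upsilon$ range over types and $\ulcorner e\urcorner$ is the quotation of $e$. Typing rules: $\mathsf{I}_\sigma : \sigma\to\sigma$; $\mathsf{K}_{\sigma,\tau} : \sigma\to\tau\to\sigma$; $\mathsf{S}_{\sigma,\tau,\upsilon} : (\sigma\to\tau\to\upsilon)\to(\sigma\to\tau)\to\sigma\to\upsilon$; $\mathsf{value}_\sigma : \mathsf{term}\to\sigma$; $\mathsf{lift} : \mathsf{term}\to\mathsf{term}$; $\mathsf{app} : \mathsf{term}\to\mathsf{term}\to\mathsf{term}$; if $e_1 : \sigma\to\tau$ and $e_2:\sigma$ then $e_1\,e_2 : \tau$; if $e:\sigma$ then $\ulcorner e\urcorner : \mathsf{term}$. (Application associates to the left; arrows associate to the right.) Basic reduction rules: $\mathsf{I}_\sigma\, e \to e$; $\mathsf{K}_{\sigma,\tau}\, e_1\, e_2 \to e_1$; $\mathsf{S}_{\sigma,\tau,\upsilon}\,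 e_1\, e_2\, e_3 \to e_1\, e_3\, (e_2\, e_3)$; if $e:\sigma$ then $\mathsf{value}_\sigma\,\ulcorner e\urcorner \to e$; $\mathsf{lift}\,\ulcorner s\urcorner \to \ulcorner\ulcorner s\urcorner\urcorner$; if $e_1\,e_2$ is well typed then $\mathsf{app}\,\ulcorner e_1\urcorner\,\ulcorner e_2\urcorner \to \ulcorner e_1\,e_2\urcorner$. One-step reduction is the closure of these rules under congruence (reducing a subterm inside an application), and the reduction relation $\Rightarrow$ is its reflexive–transitive closure. A system is strongly normalizing if no well-typed term admits an infinite sequence of one-step reductions. -}

module Defs where

open import Data.Nat using (ℕ; suc)

data Ty : Set where
  bool unit term : Ty
  _⇒_ : Ty → Ty → Ty

infixr 5 _⇒_

data Tm : Ty → Set where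
  I     : ∀ σ → Tm (σ ⇒ σ)
  K     : ∀ σ τ → Tm (σ ⇒ τ ⇒ σ)
  S     : ∀ σ τ υ → Tm ((σ ⇒ τ ⇒ υ) ⇒ (σ ⇒ τ) ⇒ σ ⇒ υ)
  value : ∀ σ → Tm (term ⇒ σ)
  lift  : Tm (term ⇒ term)
  appC  : Tm (term ⇒ term ⇒ term)
  _·_   : ∀ {σ τ} → Tm (σ ⇒ τ) → Tm σ → Tm τ
  ⌜_⌝   : ∀ {σ} → Tm σ → Tm term

infixl 7 _·_

data _⟶_ : ∀ {σ} → Tm σ → Tm σ → Set where
  βI     : ∀ {σ} (e : Tm σ) → (I σ · e) ⟶ e
  βK     : ∀ {σ τ} (e₁ : Tm σ) (e₂ : Tm τ) → (K σ τ · e₁ · e₂) ⟶ e₁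
  βS     : ∀ {σ τ υ} (e₁ : Tm (σ ⇒ τ ⇒ υ)) (e₂ : Tm (σ ⇒ τ)) (e₃ : Tm σ) →
           (S σ τ υ · e₁ · e₂ · e₃) ⟶ (e₁ · e₃ · (e₂ · e₃))
  βvalue : ∀ {σ} (e : Tm σ) → (value σ · ⌜ e ⌝) ⟶ e
  βlift  : ∀ {σ} (s : Tm σ) → (lift · ⌜ s ⌝) ⟶ ⌜ ⌜ s ⌝ ⌝
  βapp   : ∀ {σ τ} (e₁ : Tm (σ ⇒ τ)) (e₂ : Tm σ) →
           (appC · ⌜ e₁ ⌝ · ⌜ e₂ ⌝) ⟶ ⌜ e₁ · e₂ ⌝
  congˡ  : ∀ {σ τ} {f f' : Tm (σ ⇒ τ)} (a : Tm σ) → f ⟶ f' → (f · a) ⟶ (f' · a)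
  congʳ  : ∀ {σ τ} (f : Tm (σ ⇒ τ)) {a a' : Tm σ} → a ⟶ a' → (f · a) ⟶ (f · a')

infix 4 _⟶_

-- With W = S value I : term → term, the term W ⌜W⌝ reduces to value ⌜W⌝ (I ⌜W⌝),
-- then to W (I ⌜W⌝), then back to W ⌜W⌝: evaluation of quotations lets a term
-- apply itself, as in the untyped Ω.
module Submission where

open import Defs
open import Data.Nat using (ℕ; suc)
open import Data.Product using (Σ; _×_; _,_)
open import Relation.Binary.PropositionalEquality using (_≡_; refl)

record ThreeCycle (σ : Ty) : Set where
  field
    start middle end : Tm σ
    start⟶middle : start ⟶ middle
    middle⟶end   : middle ⟶ end
    end⟶start     : end ⟶ start

module _ {σ : Ty} (c : ThreeCycle σ) where
  open ThreeCycle c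

  unfold : ℕ → Tm σ
  unfold 0 = start
  unfold 1 = middle
  unfold 2 = end
  unfold (suc (suc (suc n))) = unfold n

  unfold-step : (n : ℕ) → unfold n ⟶ unfold (suc n)
  unfold-step 0 = start⟶middle
  unfold-step 1 = middle⟶end
  unfold-step 2 = end⟶start
  unfold-step (suc (suc (suc n))) = unfold-step n

selfApply : Tm (term ⇒ term)
selfApply = S term term term · value (term ⇒ term) · I term

selfApply-cycle : ThreeCycle term
selfApply-cycle = record
  { start        = selfApply · ⌜ selfApply ⌝
  ; middle       = value (term ⇒ term) · ⌜ selfApply ⌝ · (I term · ⌜ selfApply ⌝)
  ; end          = selfApply · (I term · ⌜ selfApply ⌝)
  ; start⟶middle = βS _ _ _
  ; middle⟶end   = congˡ _ (βvalue selfApply)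
  ; end⟶start     = congʳ selfApply (βI _)
  }

theorem1 : Σ Ty λ σ → Σ (Tm σ) λ t → Σ (ℕ → Tm σ) λ ts →
    (ts 0 ≡ t) × ((n : ℕ) → ts n ⟶ ts (suc n))
theorem1 = term , ThreeCycle.start selfApply-cycle , unfold selfApply-cycle , refl
         , unfold-step selfApply-cycle
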